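{- For every $k\in\mathbb{N}$, $\mathrm{TPTL}_{k+1}$ is strictly more expressive than $\mathrm{TPTL}_k$, where $\mathrm{TPTL}_k$ is the set of TPTL formulas of until rank at most $k$.
   Context: Data words: infinite sequences $(P_0,d_0)(P_1,d_1)\dots$ with $P_i\subseteq\mathcal{P}$ (finite set of propositions) and $d_i\in\mathbb{N}$. Intervals are integer intervals with endpoints in $\mathbb{Z}\cup\{\pm\infty\}$. TPTL: $\varphi::=p\mid x\in I\mid\neg\varphi\mid\varphi_1\wedge\varphi_2\mid\varphi_1\mathsf{U}\varphi_2\mid x.\varphi$; $(w,i,\nu)\models p$ iff $p\in P_i$; $(w,i,\nu)\models x\in I$ iff $d_i-\nu(x)\in I$; $(w,i,\nu)\models x.\varphi$ iff $(w,i,\nu[x\mapsto d_i])\models\varphi$; $(w,i,\nu)\models\varphi_1\mathsf{U}\varphi_2$ iff there is $j>i$ with $(w,j,\nu)\models\varphi_2$ and $(w,k,\nu)\models\varphi_1$ for all $i<k<j$; $w\models\varphi$ iff $(w,0,\nu_0)\models\varphi$ with $\nu_0$ mapping all registers to $d_0$. Until rank: $\mathrm{urk}(p)=\mathrm{urk}(x\in I)=0$, $\mathrm{urk}(\neg\varphi)=\mathrm{urk}(x.\varphi)=\mathrm{urk}(\varphi)$, $\mathrm{urk}(\varphi_1\wedge\varphi_2)=\max(\mathrm{urk}\varphi_1,\mathrm{urk}\varphi_2)$, $\mathrm{urk}(\varphi_1\mathsf{U}\varphi_2)=\max(\mathrm{urk}\varphi_1,\mathrm{urk}\varphi_2)+1$.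 Strictly more expressive: every formula of the smaller logic has an equivalent (same satisfying data words) in the larger, but not conversely. -}

module Defs where

open import Data.Nat using (ℕ; zero; suc; _⊔_; _≤_)
open import Data.Integer using (ℤ; +_; _-_) renaming (_≤_ to _≤ℤ_)
open import Data.Fin using (Fin)
open import Data.Fin.Subset using (Subset; _∈_)
open import Data.Maybe using (Maybe; just; nothing)
open import Data.Product using (_×_; _,_; proj₁; proj₂; Σ; ∃)
open import Data.Unit using (⊤)
open import Relation.Nullary using (¬_)
open import Relation.Binary.PropositionalEquality using (_≡_)

Reg : Set
Reg = ℕ

-- Integer intervals with endpoints in ℤ ∪ {±∞}:
-- lower endpoint (nothing = -∞), upper endpoint (nothing = +∞), both inclusive
-- (for integer intervals every open finite bound is an inclusive one).
record Interval : Set where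
  constructor [_,_]
  field
    lo : Maybe ℤ
    hi : Maybe ℤ

LoOK : Maybe ℤ → ℤ → Set
LoOK nothing  z = ⊤
LoOK (just a) z = a ≤ℤ z

HiOK : Maybe ℤ → ℤ → Set
HiOK nothing  z = ⊤
HiOK (just b) z = z ≤ℤ b

_∈I_ : ℤ → Interval → Set
z ∈I I = LoOK (Interval.lo I) z × HiOK (Interval.hi I) z

data TPTL (n : ℕ) : Set where
  prop  : Fin n → TPTL n
  _∈ᶜ_  : Reg → Interval → TPTL n
  ¬ᶠ_   : TPTL n → TPTL n
  _∧ᶠ_  : TPTL n → TPTL n → TPTL n
  _Uᶠ_  : TPTL n → TPTL n → TPTL n
  frz   : Reg → TPTL n → TPTL n

urk : ∀ {n} → TPTL n → ℕ
urk (prop p)   = 0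
urk (x ∈ᶜ I)   = 0
urk (¬ᶠ φ)     = urk φ
urk (φ ∧ᶠ ψ)   = urk φ ⊔ urk ψ
urk (φ Uᶠ ψ)   = suc (urk φ ⊔ urk ψ)
urk (frz x φ)  = urk φ

DataWord : ℕ → Set
DataWord n = ℕ → Subset n × ℕ

Valuation : Set
Valuation = Reg → ℕ

module _ {n : ℕ} (w : DataWord n) where

  P : ℕ → Subset n
  P i = proj₁ (w i)

  d : ℕ → ℕ
  d i = proj₂ (w i)

  update : Valuation → Reg → ℕ → Valuation
  update ν x v y with Data.Nat._≟_ x y
  ... | Relation.Nullary.yes _ = v
  ... | Relation.Nullary.no  _ = ν y

  Sat : ℕ → Valuation → TPTL n → Set
  Sat i ν (prop p)  = p ∈ P i
  Sat i ν (x ∈ᶜ I)  = ((+ d i) - (+ ν x)) ∈I I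
  Sat i ν (¬ᶠ φ)    = ¬ Sat i ν φ
  Sat i ν (φ ∧ᶠ ψ)  = Sat i ν φ × Sat i ν ψ
  Sat i ν (φ Uᶠ ψ)  = Σ ℕ λ j → (Data.Nat._<_ i j) × Sat j ν ψ ×
                        (∀ k → Data.Nat._<_ i k → Data.Nat._<_ k j → Sat k ν φ)
  Sat i ν (frz x φ) = Sat i (update ν x (d i)) φ

_⊨_ : ∀ {n} → DataWord n → TPTL n → Set
w ⊨ φ = Sat w 0 (λ _ → d w 0) φ

Equivalent : ∀ {n} → TPTL n → TPTL n → Set
Equivalent φ ψ = ∀ w → (w ⊨ φ → w ⊨ ψ) × (w ⊨ ψ → w ⊨ φ)

InTPTL : ∀ {n} → ℕ → TPTL n → Set
InTPTL k φ = urk φ ≤ k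

AtLeastAsExpressive : ∀ {n} → (TPTL n → Set) → (TPTL n → Set) → Set
AtLeastAsExpressive {n} L' L =
  ∀ φ → L φ → Σ (TPTL n) λ ψ → L' ψ × Equivalent φ ψ

StrictlyMoreExpressive : ∀ {n} → (TPTL n → Set) → (TPTL n → Set) → Set
StrictlyMoreExpressive L' L =
  AtLeastAsExpressive L' L × ¬ AtLeastAsExpressive L L'

-- Let wₘ be the data word 0ᵐ1^ω without propositions. Whether wₘ satisfies a formula at
-- position i under ν depends only on ν and the number c = m ∸ i of zeros still ahead, and a
-- formula of until rank r cannot tell two such counters apart once both exceed r: an
-- Until-move to counter c ∸ s on one side is answered on the other side by the same counter
-- when that is at most r, and by a single step otherwise, while every intermediate counter can
-- be matched by one capped at r + 1. So no formula of rank k separates w₍ₖ₊₂₎ from w₍ₖ₊₁₎,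
-- whereas X^(k+1) (x ∈ [0,0]) does: it asks whether the datum at position k + 1 is still d₀.
module Submission where

open import Defs
open import Data.Nat
  using (ℕ; zero; suc; _+_; _∸_; _⊓_; _<_; _≤_; _≟_; _≤?_; _<?_; z≤n; s≤s; s≤s⁻¹; s<s⁻¹)
open import Data.Nat.Properties
open import Data.Integer using (+_; _-_; +≤+)
open import Data.Fin.Subset using (⊥)
open import Data.Maybe using (just; nothing)
open import Data.Product using (_×_; _,_; Σ; proj₁; proj₂)
open import Data.Sum using (_⊎_; inj₁; inj₂)
open import Data.Empty using (⊥-elim)
open import Data.Unit using (tt)
open import Function using (id; _∘_)
open import Relation.Nullary using (¬_; yes; no)
open import Relation.Binary.PropositionalEquality hiding ([_])

infix 4 _≃[_]_

_≃[_]_ : ℕ → ℕ → ℕ → Set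
a ≃[ r ] b = a ≡ b ⊎ (r < a × r < b)

≃-sym : ∀ {r a b} → a ≃[ r ] b → b ≃[ r ] a
≃-sym (inj₁ a≡b)         = inj₁ (sym a≡b)
≃-sym (inj₂ (r<a , r<b)) = inj₂ (r<b , r<a)

≃-pres-> : ∀ {r a b x} → x ≤ r → a ≃[ r ] b → x < a → x < b
≃-pres-> _   (inj₁ refl)      x<a = x<a
≃-pres-> x≤r (inj₂ (_ , r<b)) _   = ≤-<-trans x≤r r<b

≃-zero : ∀ {r a} → a ≃[ suc r ] 0 → a ≡ 0
≃-zero (inj₁ a≡0)     = a≡0
≃-zero (inj₂ (_ , ()))

⊓-≃ : ∀ r v → v ⊓ suc r ≃[ r ] v
⊓-≃ r v with v ≤? r
... | yes v≤r = inj₁ (m≤n⇒m⊓n≡m (m≤n⇒m≤1+n v≤r))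
... | no  v≰r = inj₂ (subst (r <_) (sym (m≥n⇒m⊓n≡n r<v)) (n<1+n r) , r<v)
  where r<v = ≰⇒> v≰r

m∸n<m : ∀ {m n} → 0 < m → 0 < n → m ∸ n < m
m∸n<m {suc m} {suc n} _ _ = s≤s (m∸n≤m m n)

∸-intermediate-value : ∀ {a s c} → a ∸ s < c → c < a → Σ ℕ λ s′ → 0 < s′ × s′ < s × a ∸ s′ ≡ c
∸-intermediate-value {a} {s} {c} a∸s<c c<a =
  a ∸ c , m<n⇒0<n∸m c<a , ∸-cancelʳ-< (subst (a ∸ s <_) (sym a∸[a∸c]≡c) a∸s<c) , a∸[a∸c]≡c
  where a∸[a∸c]≡c = m∸[m∸n]≡n (<⇒≤ c<a)

-- The reply, from counter b, to an Until-witness at offset s from counter a.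
UntilAnswer : ℕ → ℕ → ℕ → ℕ → ℕ → Set
UntilAnswer r a b s t =
  0 < t × a ∸ s ≃[ r ] b ∸ t ×
  (∀ {t′} → 0 < t′ → t′ < t → Σ ℕ λ s′ → 0 < s′ × s′ < s × a ∸ s′ ≃[ r ] b ∸ t′)

untilAnswer : ∀ {r a b s} → a ≃[ suc r ] b → 0 < s → Σ ℕ (UntilAnswer r a b s)
untilAnswer {r} {a} {zero} {s} a≃0 _ =
  1 , s≤s z≤n , inj₁ (trans (cong (_∸ s) (≃-zero a≃0)) (0∸n≡0 s)) ,
  λ { {suc _} _ (s≤s ()) }
untilAnswer {r} {a} {b@(suc _)} {s} a≃b 0<s with a ∸ s ≤? r
... | no a∸s≰r = 1 , s≤s z≤n , inj₂ (≰⇒> a∸s≰r , r<b∸1) , λ { {suc _} _ (s≤s ()) }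
  where
  1+r<a : suc r < a
  1+r<a = ≤-<-trans (≰⇒> a∸s≰r) (m∸n<m (≃-pres-> z≤n (≃-sym a≃b) (s≤s z≤n)) 0<s)
  r<b∸1 : r < b ∸ 1
  r<b∸1 = s<s⁻¹ (≃-pres-> ≤-refl a≃b 1+r<a)
... | yes a∸s≤r = b ∸ u , m<n⇒0<n∸m u<b , inj₁ (sym b∸[b∸u]≡u) , match
  where
  u = a ∸ s
  u<b : u < b
  u<b = ≃-pres-> (m≤n⇒m≤1+n a∸s≤r) a≃b (m∸n<m (≃-pres-> z≤n (≃-sym a≃b) (s≤s z≤n)) 0<s)
  b∸[b∸u]≡u = m∸[m∸n]≡n (<⇒≤ u<b)
  match : ∀ {t′} → 0 < t′ → t′ < b ∸ u → Σ ℕ λ s′ → 0 < s′ × s′ < s × a ∸ s′ ≃[ r ] b ∸ t′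
  match {t′} 0<t′ t′<b∸u with ∸-intermediate-value u<c c<a
    where
    v = b ∸ t′
    u<v : u < v
    u<v = subst (_< v) b∸[b∸u]≡u (∸-monoʳ-< t′<b∸u (m∸n≤m b u))
    u<c : u < v ⊓ suc r
    u<c = ⊓-pres-m< u<v (s≤s a∸s≤r)
    c<a : v ⊓ suc r < a
    c<a = ≃-pres-> (m⊓n≤n v (suc r)) (≃-sym a≃b) (m<n⇒m⊓o<n (suc r) (m∸n<m (s≤s z≤n) 0<t′))
  ... | s′ , 0<s′ , s′<s , a∸s′≡c =
    s′ , 0<s′ , s′<s , subst (_≃[ r ] b ∸ t′) (sym a∸s′≡c) (⊓-≃ r (b ∸ t′))

update-cong : ∀ {n} (w₁ w₂ : DataWord n) {ν₁ ν₂ : Valuation} x {v₁ v₂ : ℕ} →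
              v₁ ≡ v₂ → ν₁ ≗ ν₂ → update w₁ ν₁ x v₁ ≗ update w₂ ν₂ x v₂
update-cong _ _ x v₁≡v₂ ν₁≗ν₂ y with x ≟ y
... | yes _ = v₁≡v₂
... | no  _ = ν₁≗ν₂ y

UntilAfter : ∀ {n} → DataWord n → ℕ → Valuation → TPTL n → TPTL n → Set
UntilAfter w i ν φ ψ =
  Σ ℕ λ s → 0 < s × Sat w (i + s) ν ψ × (∀ {s′} → 0 < s′ → s′ < s → Sat w (i + s′) ν φ)

Sat-U⇒UntilAfter : ∀ {n} {w : DataWord n} {i ν φ ψ} → Sat w i ν (φ Uᶠ ψ) → UntilAfter w i ν φ ψ
Sat-U⇒UntilAfter {w = w} {i} {ν} {ψ = ψ} (j , i<j , ψ-at-j , φ-before-j) =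
  j ∸ i , m<n⇒0<n∸m i<j , subst (λ p → Sat w p ν ψ) (sym i+[j∸i]≡j) ψ-at-j ,
  λ 0<s′ s′<j∸i → φ-before-j _ (m<m+n i 0<s′) (subst (i + _ <_) i+[j∸i]≡j (+-monoʳ-< i s′<j∸i))
  where i+[j∸i]≡j = m+[n∸m]≡n (<⇒≤ i<j)

UntilAfter⇒Sat-U : ∀ {n} {w : DataWord n} {i ν φ ψ} → UntilAfter w i ν φ ψ → Sat w i ν (φ Uᶠ ψ)
UntilAfter⇒Sat-U {w = w} {i} {ν} {φ} (s , 0<s , ψ-after-s , φ-before-s) =
  i + s , m<m+n i 0<s , ψ-after-s ,
  λ k i<k k<i+s → let i+[k∸i]≡k = m+[n∸m]≡n (<⇒≤ i<k) in
    subst (λ p → Sat w p ν φ) i+[k∸i]≡k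
      (φ-before-s (m<n⇒0<n∸m i<k) (+-cancelˡ-< i _ _ (subst (_< i + s) (sym i+[k∸i]≡k) k<i+s)))

oneIfZero : ℕ → ℕ
oneIfZero zero    = 1
oneIfZero (suc _) = 0

oneIfZero-cong : ∀ {r a b} → a ≃[ r ] b → oneIfZero a ≡ oneIfZero b
oneIfZero-cong (inj₁ a≡b)                          = cong oneIfZero a≡b
oneIfZero-cong {a = suc _} {b = suc _} (inj₂ _) = refl

zerosThenOnes : ∀ {n} → ℕ → DataWord n
zerosThenOnes m i = ⊥ , oneIfZero (m ∸ i)

≃-∸-+-assoc : ∀ {r} m₁ i₁ s m₂ i₂ t →
              m₁ ∸ i₁ ∸ s ≃[ r ] m₂ ∸ i₂ ∸ t → m₁ ∸ (i₁ + s) ≃[ r ] m₂ ∸ (i₂ + t)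
≃-∸-+-assoc {r} m₁ i₁ s m₂ i₂ t = subst₂ _≃[ r ]_ (∸-+-assoc m₁ i₁ s) (∸-+-assoc m₂ i₂ t)

Sat-transfer : ∀ {n} (φ : TPTL n) {r} → urk φ ≤ r →
               ∀ m₁ i₁ m₂ i₂ {ν₁ ν₂ : Valuation} → ν₁ ≗ ν₂ → m₁ ∸ i₁ ≃[ r ] m₂ ∸ i₂ →
               Sat (zerosThenOnes m₁) i₁ ν₁ φ → Sat (zerosThenOnes m₂) i₂ ν₂ φ
Sat-transfer (prop p) _ _ _ _ _ _ _ holds = holds
Sat-transfer (x ∈ᶜ I) _ _ _ _ _ ν₁≗ν₂ c₁≃c₂ =
  subst₂ (λ dᵢ vₓ → ((+ dᵢ) - (+ vₓ)) ∈I I) (oneIfZero-cong c₁≃c₂) (ν₁≗ν₂ x)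
Sat-transfer (¬ᶠ φ) urk≤r m₁ i₁ m₂ i₂ ν₁≗ν₂ c₁≃c₂ ¬holds =
  ¬holds ∘ Sat-transfer φ urk≤r m₂ i₂ m₁ i₁ (sym ∘ ν₁≗ν₂) (≃-sym c₁≃c₂)
Sat-transfer (φ ∧ᶠ ψ) urk≤r m₁ i₁ m₂ i₂ ν₁≗ν₂ c₁≃c₂ (φ-holds , ψ-holds) =
  Sat-transfer φ (m⊔n≤o⇒m≤o (urk φ) (urk ψ) urk≤r) m₁ i₁ m₂ i₂ ν₁≗ν₂ c₁≃c₂ φ-holds ,
  Sat-transfer ψ (m⊔n≤o⇒n≤o (urk φ) (urk ψ) urk≤r) m₁ i₁ m₂ i₂ ν₁≗ν₂ c₁≃c₂ ψ-holds
Sat-transfer {n} (frz x φ) urk≤r m₁ i₁ m₂ i₂ ν₁≗ν₂ c₁≃c₂ =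
  Sat-transfer φ urk≤r m₁ i₁ m₂ i₂
    (update-cong (zerosThenOnes {n} m₁) (zerosThenOnes m₂) x (oneIfZero-cong c₁≃c₂) ν₁≗ν₂) c₁≃c₂
Sat-transfer (φ Uᶠ ψ) {suc r} (s≤s urk≤r) m₁ i₁ m₂ i₂ {ν₂ = ν₂} ν₁≗ν₂ c₁≃c₂ holds
  with Sat-U⇒UntilAfter {w = zerosThenOnes m₁} {φ = φ} {ψ} holds
... | s , 0<s , ψ-holds , φ-holds with untilAnswer c₁≃c₂ 0<s
... | t , 0<t , c≃ , match =
  UntilAfter⇒Sat-U {w = zerosThenOnes m₂} {φ = φ} {ψ} (t , 0<t , ψ-transfer , φ-transfer)
  where
  ψ-transfer = Sat-transfer ψ (m⊔n≤o⇒n≤o (urk φ) (urk ψ) urk≤r) m₁ (i₁ + s) m₂ (i₂ + t) ν₁≗ν₂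
                 (≃-∸-+-assoc m₁ i₁ s m₂ i₂ t c≃) ψ-holds
  φ-transfer : ∀ {t′} → 0 < t′ → t′ < t → Sat (zerosThenOnes m₂) (i₂ + t′) ν₂ φ
  φ-transfer {t′} 0<t′ t′<t with match 0<t′ t′<t
  ... | s′ , 0<s′ , s′<s , c′≃ =
    Sat-transfer φ (m⊔n≤o⇒m≤o (urk φ) (urk ψ) urk≤r) m₁ (i₁ + s′) m₂ (i₂ + t′) ν₁≗ν₂
      (≃-∸-+-assoc m₁ i₁ s′ m₂ i₂ t′ c′≃) (φ-holds 0<s′ s′<s)

next : ∀ {n} → TPTL n → TPTL n
next ψ = (¬ᶠ (0 ∈ᶜ [ nothing , nothing ])) Uᶠ ψ

next-elim : ∀ {n} {w : DataWord n} {i ν} ψ → Sat w i ν (next ψ) → Sat w (suc i) ν ψ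
next-elim {w = w} {i} {ν} ψ (j , i<j , ψ-at-j , φ-before-j) with suc i <? j
... | yes 1+i<j = ⊥-elim (φ-before-j (suc i) ≤-refl 1+i<j (tt , tt))
... | no  1+i≮j = subst (λ p → Sat w p ν ψ) (≤-antisym (≮⇒≥ 1+i≮j) i<j) ψ-at-j

next-intro : ∀ {n} {w : DataWord n} {i ν} ψ → Sat w (suc i) ν ψ → Sat w i ν (next ψ)
next-intro ψ ψ-holds = _ , ≤-refl , ψ-holds , λ _ i<k k<1+i → ⊥-elim (<⇒≱ i<k (s≤s⁻¹ k<1+i))

nextⁿ : ∀ {n} → ℕ → TPTL n → TPTL n
nextⁿ zero    ψ = ψ
nextⁿ (suc k) ψ = next (nextⁿ k ψ)

urk-nextⁿ : ∀ {n} k (ψ : TPTL n) → urk (nextⁿ k ψ) ≡ k + urk ψ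
urk-nextⁿ zero    ψ = refl
urk-nextⁿ (suc k) ψ = cong suc (urk-nextⁿ k ψ)

nextⁿ-elim : ∀ {n} {w : DataWord n} {ν} k {i} ψ → Sat w i ν (nextⁿ k ψ) → Sat w (k + i) ν ψ
nextⁿ-elim zero          ψ = id
nextⁿ-elim {w = w} {ν} (suc k) {i} ψ =
  subst (λ p → Sat w p ν ψ) (+-suc k i) ∘ nextⁿ-elim k ψ ∘ next-elim (nextⁿ k ψ)

nextⁿ-intro : ∀ {n} {w : DataWord n} {ν} k {i} ψ → Sat w (k + i) ν ψ → Sat w i ν (nextⁿ k ψ)
nextⁿ-intro zero          ψ = id
nextⁿ-intro {w = w} {ν} (suc k) {i} ψ =
  next-intro (nextⁿ k ψ) ∘ nextⁿ-intro k ψ ∘ subst (λ p → Sat w p ν ψ) (sym (+-suc k i))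

datum≡x₀ : ∀ {n} → TPTL n
datum≡x₀ = 0 ∈ᶜ [ just (+ 0) , just (+ 0) ]

datum≡x₀-before : ∀ {n} m p → p < m → Sat (zerosThenOnes {n} m) p (λ _ → 0) datum≡x₀
datum≡x₀-before m p p<m with m ∸ p | m<n⇒0<n∸m p<m
... | suc _ | _ = +≤+ z≤n , +≤+ z≤n

datum≡x₀-after : ∀ {n} m p → m ≤ p → ¬ Sat (zerosThenOnes {n} m) p (λ _ → 0) datum≡x₀
datum≡x₀-after _ _ m≤p rewrite m≤n⇒m∸n≡0 m≤p = λ { (_ , +≤+ ()) }

TPTL-mono : ∀ {n k l} → k ≤ l → AtLeastAsExpressive {n} (InTPTL l) (InTPTL k)
TPTL-mono k≤l φ urk≤k = φ , ≤-trans urk≤k k≤l , λ _ → id , id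

nextⁿ-inexpressible : ∀ {n} k → ¬ Σ (TPTL n) λ ψ → InTPTL k ψ × Equivalent (nextⁿ (suc k) datum≡x₀) ψ
nextⁿ-inexpressible {n} k (ψ , urk≤k , φ⇔ψ) = datum-changed (proj₂ (φ⇔ψ short) ψ-on-short)
  where
  long short : DataWord n
  long  = zerosThenOnes (2 + k)
  short = zerosThenOnes (1 + k)
  datum-kept : long ⊨ nextⁿ (suc k) datum≡x₀
  datum-kept = nextⁿ-intro (suc k) datum≡x₀
                 (datum≡x₀-before {n} (2 + k) (suc k + 0) (s≤s (≤-reflexive (+-identityʳ (suc k)))))
  datum-changed : ¬ short ⊨ nextⁿ (suc k) datum≡x₀
  datum-changed =
    datum≡x₀-after {n} (1 + k) (suc k + 0) (m≤m+n (suc k) 0) ∘ nextⁿ-elim (suc k) datum≡x₀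
  ψ-on-short : short ⊨ ψ
  ψ-on-short = Sat-transfer ψ urk≤k (2 + k) 0 (1 + k) 0 (λ _ → refl)
                 (inj₂ (m<n⇒m<1+n (n<1+n k) , n<1+n k)) (proj₁ (φ⇔ψ long) datum-kept)

proposition11 : (n : ℕ) (k : ℕ) →
    StrictlyMoreExpressive {n} (InTPTL (suc k)) (InTPTL k)
proposition11 n k = TPTL-mono (n≤1+n k) , λ expressible →
  nextⁿ-inexpressible k (expressible (nextⁿ (suc k) datum≡x₀) urk≤1+k)
  where
  urk≤1+k : urk {n} (nextⁿ (suc k) datum≡x₀) ≤ suc k
  urk≤1+k = ≤-reflexive (trans (urk-nextⁿ (suc k) datum≡x₀) (+-identityʳ (suc k)))
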